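{- Let $k\ge 2$ and let $\mathcal{H}$ and $\mathcal{H}'$ be $k$-uniform threshold hypergraphs on $n$ vertices given by binary sequences $(b_1,\dots,b_n)_k$ and $(b'_1,\dots,b'_n)_k$, respectively. If $\mathcal{H}$ and $\mathcal{H}'$ have the same adjacency matrix, then $(b_1,\dots,b_n)=(b'_1,\dots,b'_n)$.
   Context: Let $k\ge 2$ and $n$ be positive integers and let $(b_1,\dots,b_n)_k$ be a binary sequence ($b_i\in\{0,1\}$) with $b_1=\dots=b_{k-1}=0$. The $k$-uniform threshold hypergraph $\mathcal{H}=(V,E)$ given by this sequence has (ordered) vertex set $V=\{v_1,\dots,v_n\}$, and a set $e$ is an edge if and only if $e$ is a $k$-element subset of $V$ and $b_j=1$, where $j=\max\{i: v_i\in e\}$. The adjacency matrix $A(\mathcal{H})=(a_{i,j})$ is the $n\times n$ symmetric matrix with $a_{i,j}=|\{e\in E: v_i,v_j\in e\}|$ for $i\ne j$ and $a_{i,i}=0$ (rows and columns indexed according to the order $v_1,\dots,v_n$). -}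

module Defs where

open import Data.Nat using (ℕ; zero; suc; _≡ᵇ_)
open import Data.Bool using (Bool; true; false; _∧_; if_then_else_)
open import Data.Fin using (Fin; zero; suc)
open import Data.Fin.Subset using (Subset; ∣_∣)
open import Data.Vec using (Vec; []; _∷_; lookup)
open import Data.List using (List; []; _∷_; map; _++_; filter; length)
open import Data.Maybe using (Maybe; just; nothing)
open import Relation.Nullary using (yes; no)
open import Data.Fin using (_≟_)
open import Relation.Binary.PropositionalEquality using (_≡_)
open import Data.Bool.Properties using () renaming (_≟_ to _≟𝔹_)

-- Vertices v_1, …, v_n are represented by Fin n (index i stands for v_{i+1}).
-- A binary sequence (b_1,…,b_n) is a function Fin n → Bool (true = 1).

allSubsets : (n : ℕ) → List (Subset n)
allSubsets zero = [] ∷ []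
allSubsets (suc n) = map (false ∷_) (allSubsets n) ++ map (true ∷_) (allSubsets n)

maxElem : ∀ {n} → Subset n → Maybe (Fin n)
maxElem [] = nothing
maxElem (x ∷ p) with maxElem p
... | just j = just (suc j)
... | nothing = if x then just zero else nothing

isEdge : ∀ {n} → ℕ → (Fin n → Bool) → Subset n → Bool
isEdge k b e with maxElem e
... | just j = (∣ e ∣ ≡ᵇ k) ∧ b j
... | nothing = false

edges : ∀ {n} → ℕ → (Fin n → Bool) → List (Subset n)
edges {n} k b = filter (λ e → isEdge k b e ≟𝔹 true) (allSubsets n)

adjacency : ∀ {n} → ℕ → (Fin n → Bool) → Fin n → Fin n → ℕ
adjacency k b i j with i ≟ j
... | yes _ = 0
... | no _ = length (filter (λ e → (lookup e i ∧ lookup e j) ≟𝔹 true) (edges k b))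

-- Read the sequences from the top index down.  Suppose b and b′ agree above
-- an index i ≥ k - 1 but b_i = 1 and b′_i = 0.  Every edge of H′ through v_1
-- and v_i has its top vertex strictly above i, hence is also an edge of H;
-- and {v_1, …, v_{k-1}, v_i} is an edge of H but not of H′.  So the (1, i)
-- entries of the adjacency matrices differ.  Below k - 1 both sequences are 0.
module Submission where

open import Defs
open import Data.Nat using (ℕ; _≤_; _<_; _∸_)
open import Data.Bool using (Bool; false)
open import Data.Fin using (Fin; toℕ)
open import Relation.Binary.PropositionalEquality using (_≡_)

open import Level using (0ℓ)
open import Data.Nat using (zero; suc; z≤n; s≤s; _≡ᵇ_; _<?_)
open import Data.Nat.Properties using (≡⇒≡ᵇ; m≤n⇒m≤1+n; <⇒≢; ≮⇒≥; module ≤-Reasoning)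
open import Data.Bool using (true; _∧_)
open import Data.Bool.Properties using (∧-zeroʳ; T-≡) renaming (_≟_ to _≟𝔹_)
open import Data.Fin using (zero; suc) renaming (_<_ to _<ᶠ_)
open import Data.Fin.Properties using (≤∧≢⇒<)
open import Data.Fin.Induction using (>-wellFounded)
open import Data.Fin.Subset using (Subset; ∣_∣; ⊥; inside; outside)
open import Data.Fin.Subset.Properties using (∣⊥∣≡0)
open import Data.Vec using ([]; _∷_; lookup)
open import Data.List using (List; []; _∷_; filter; length; map)
open import Data.List.Properties using (filter-accept; filter-reject)
open import Data.List.Membership.Propositional using (_∈_)
open import Data.List.Membership.Propositional.Properties using (∈-map⁺; ∈-++⁺ˡ; ∈-++⁺ʳ)
open import Data.List.Relation.Unary.Any using (here; there)
open import Data.Maybe using (just; nothing)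
open import Data.Product using (_,_)
open import Function.Bundles using (Equivalence)
open import Induction.WellFounded using (module All)
open import Relation.Binary.PropositionalEquality using (_≢_; refl; sym; trans; cong; module ≡-Reasoning)
open import Relation.Nullary using (¬_; yes; no; contradiction)
open import Relation.Unary using (Pred; Decidable; _⊆_; _∩_)
open import Relation.Unary.Properties using (_∩?_)

module _ {a p q} {A : Set a} {P : Pred A p} {Q : Pred A q}
         (P? : Decidable P) (Q? : Decidable Q) where

  filter-filter : ∀ xs → filter Q? (filter P? xs) ≡ filter (P? ∩? Q?) xs
  filter-filter [] = refl
  filter-filter (x ∷ xs) with P? x
  ... | no _ = filter-filter xs
  ... | yes _ with Q? x
  ...   | yes _ = cong (x ∷_) (filter-filter xs)
  ...   | no _  = filter-filter xs

  module _ (P⊆Q : P ⊆ Q) where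

    length-filter-mono : ∀ xs → length (filter P? xs) ≤ length (filter Q? xs)
    length-filter-mono [] = z≤n
    length-filter-mono (x ∷ xs) with P? x | Q? x
    ... | yes _  | yes _   = s≤s (length-filter-mono xs)
    ... | yes px | no ¬qx  = contradiction (P⊆Q px) ¬qx
    ... | no _   | yes _   = m≤n⇒m≤1+n (length-filter-mono xs)
    ... | no _   | no _    = length-filter-mono xs

    length-filter-< : ∀ {x xs} → x ∈ xs → Q x → ¬ P x →
                      length (filter P? xs) < length (filter Q? xs)
    length-filter-< {xs = x ∷ xs} (here refl) qx ¬px
      rewrite filter-reject P? {xs = xs} ¬px | filter-accept Q? {xs = xs} qx = s≤s (length-filter-mono xs)
    length-filter-< {xs = y ∷ xs} (there x∈xs) qx ¬px with P? y | Q? y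
    ... | yes _  | yes _  = s≤s (length-filter-< x∈xs qx ¬px)
    ... | yes py | no ¬qy = contradiction (P⊆Q py) ¬qy
    ... | no _   | yes _  = m≤n⇒m≤1+n (length-filter-< x∈xs qx ¬px)
    ... | no _   | no _   = length-filter-< x∈xs qx ¬px

∧≡true⇒ʳ : ∀ x {y} → x ∧ y ≡ true → y ≡ true
∧≡true⇒ʳ true eq = eq

≡ᵇ-refl : ∀ n → (n ≡ᵇ n) ≡ true
≡ᵇ-refl n = Equivalence.to T-≡ (≡⇒≡ᵇ n n refl)

∈-allSubsets : ∀ {n} (s : Subset n) → s ∈ allSubsets n
∈-allSubsets [] = here refl
∈-allSubsets {suc n} (outside ∷ s) = ∈-++⁺ˡ (∈-map⁺ (outside ∷_) (∈-allSubsets s))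
∈-allSubsets {suc n} (inside ∷ s) =
  ∈-++⁺ʳ (map (outside ∷_) (allSubsets n)) (∈-map⁺ (inside ∷_) (∈-allSubsets s))

maxElem-⊥ : ∀ n → maxElem (⊥ {n}) ≡ nothing
maxElem-⊥ zero = refl
maxElem-⊥ (suc n) rewrite maxElem-⊥ n = refl

maxElem-nothing : ∀ {n} (e : Subset n) → maxElem e ≡ nothing → ∀ j → lookup e j ≡ false
maxElem-nothing (x ∷ e) eq j with maxElem e in max
maxElem-nothing (outside ∷ e) eq zero    | nothing = refl
maxElem-nothing (outside ∷ e) eq (suc j) | nothing = maxElem-nothing e max j

maxElem-≥ : ∀ {n} (e : Subset n) {m} → maxElem e ≡ just m →
            ∀ {j} → lookup e j ≡ true → toℕ j ≤ toℕ m
maxElem-≥ (x ∷ e) eq {j} e∋j with maxElem e in max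
maxElem-≥ (x ∷ e) refl {zero}  e∋j | just m = z≤n
maxElem-≥ (x ∷ e) refl {suc j} e∋j | just m = s≤s (maxElem-≥ e max e∋j)
maxElem-≥ (inside ∷ e) refl {zero} e∋j | nothing = z≤n
maxElem-≥ (inside ∷ e) refl {suc j} e∋j | nothing =
  contradiction (trans (sym e∋j) (maxElem-nothing e max j)) λ ()

isEdge-just : ∀ {n} k (b : Fin n → Bool) e {m} → maxElem e ≡ just m →
              isEdge k b e ≡ ((∣ e ∣ ≡ᵇ k) ∧ b m)
isEdge-just k b e eq rewrite eq = refl

-- The top vertex of such an edge is at least i, and not i itself since b′ i = 0.
isEdge-above : ∀ {n} k (b b′ : Fin n → Bool) {i} →
               (∀ {m} → i <ᶠ m → b′ m ≡ b m) → b′ i ≡ false →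
               ∀ e → lookup e i ≡ true → isEdge k b′ e ≡ true → isEdge k b e ≡ true
isEdge-above k b b′ {i} agree b′i≡false e e∋i edge′ with maxElem e in max
... | just m = trans (cong ((∣ e ∣ ≡ᵇ k) ∧_) (sym (agree (≤∧≢⇒< (maxElem-≥ e max e∋i) i≢m)))) edge′
  where
  i≢m : i ≢ m
  i≢m refl = contradiction (trans (sym edge′) (trans (cong ((∣ e ∣ ≡ᵇ k) ∧_) b′i≡false) (∧-zeroʳ _))) λ ()

-- {0, …, c - 1} ∪ {j}; it has c + 1 elements when c ≤ j.
⁅_⁆∪first_ : ∀ {n} → Fin n → ℕ → Subset n
⁅ zero  ⁆∪first c     = inside ∷ ⊥
⁅ suc j ⁆∪first zero  = outside ∷ ⁅ j ⁆∪first zero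
⁅ suc j ⁆∪first suc c = inside ∷ ⁅ j ⁆∪first c

maxElem-⁅⁆∪first : ∀ {n} (j : Fin n) c → maxElem (⁅ j ⁆∪first c) ≡ just j
maxElem-⁅⁆∪first {suc n} zero c rewrite maxElem-⊥ n = refl
maxElem-⁅⁆∪first (suc j) zero    rewrite maxElem-⁅⁆∪first j zero = refl
maxElem-⁅⁆∪first (suc j) (suc c) rewrite maxElem-⁅⁆∪first j c = refl

∣⁅⁆∪first∣ : ∀ {n} (j : Fin n) {c} → c ≤ toℕ j → ∣ ⁅ j ⁆∪first c ∣ ≡ suc c
∣⁅⁆∪first∣ {suc n} zero z≤n = cong suc (∣⊥∣≡0 n)
∣⁅⁆∪first∣ (suc j) z≤n = ∣⁅⁆∪first∣ j z≤n
∣⁅⁆∪first∣ (suc j) (s≤s c≤j) = cong suc (∣⁅⁆∪first∣ j c≤j)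

∈-⁅⁆∪first : ∀ {n} (j : Fin n) c → lookup (⁅ j ⁆∪first c) j ≡ true
∈-⁅⁆∪first zero    c       = refl
∈-⁅⁆∪first (suc j) zero    = ∈-⁅⁆∪first j zero
∈-⁅⁆∪first (suc j) (suc c) = ∈-⁅⁆∪first j c

isEdge-⁅⁆∪first : ∀ {n} (b : Fin n → Bool) (j : Fin n) {c} → c ≤ toℕ j →
                  isEdge (suc c) b (⁅ j ⁆∪first c) ≡ b j
isEdge-⁅⁆∪first b j {c} c≤j = begin
  isEdge (suc c) b (⁅ j ⁆∪first c)              ≡⟨ isEdge-just (suc c) b (⁅ j ⁆∪first c) (maxElem-⁅⁆∪first j c) ⟩
  (∣ ⁅ j ⁆∪first c ∣ ≡ᵇ suc c) ∧ b j           ≡⟨ cong (λ s → (s ≡ᵇ suc c) ∧ b j) (∣⁅⁆∪first∣ j c≤j) ⟩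
  (suc c ≡ᵇ suc c) ∧ b j                        ≡⟨ cong (_∧ b j) (≡ᵇ-refl (suc c)) ⟩
  b j                                           ∎
  where open ≡-Reasoning

adjacency-< : ∀ {n c} (b b′ : Fin (suc n) → Bool) (j : Fin n) → suc c ≤ toℕ (suc j) →
              (∀ {m} → suc j <ᶠ m → b′ m ≡ b m) → b (suc j) ≡ true → b′ (suc j) ≡ false →
              adjacency (suc (suc c)) b′ zero (suc j) < adjacency (suc (suc c)) b zero (suc j)
adjacency-< {n} {c} b b′ j c<i agree bi≡true b′i≡false = begin-strict
  adjacency k b′ zero i                        ≡⟨ cong length (filter-filter (edge? b′) pair? subsets) ⟩
  length (filter (edge? b′ ∩? pair?) subsets)  <⟨ length-filter-< (edge? b′ ∩? pair?) (edge? b ∩? pair?)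
                                                    (λ {e} → transfer {e}) (∈-allSubsets witness) witness∈ witness∉ ⟩
  length (filter (edge? b ∩? pair?) subsets)   ≡⟨ cong length (filter-filter (edge? b) pair? subsets) ⟨
  adjacency k b zero i                         ∎
  where
  open ≤-Reasoning
  k : ℕ
  k = suc (suc c)
  i : Fin (suc n)
  i = suc j
  subsets : List (Subset (suc n))
  subsets = allSubsets (suc n)
  witness : Subset (suc n)
  witness = ⁅ i ⁆∪first suc c
  Edge : (Fin (suc n) → Bool) → Pred (Subset (suc n)) 0ℓ
  Edge β e = isEdge k β e ≡ true
  Pair : Pred (Subset (suc n)) 0ℓ
  Pair e = (lookup e zero ∧ lookup e i) ≡ true
  edge? : ∀ β → Decidable (Edge β)
  edge? β e = isEdge k β e ≟𝔹 true
  pair? : Decidable Pair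
  pair? e = (lookup e zero ∧ lookup e i) ≟𝔹 true
  transfer : Edge b′ ∩ Pair ⊆ Edge b ∩ Pair
  transfer {e} (edge′ , pair) =
    isEdge-above k b b′ agree b′i≡false e (∧≡true⇒ʳ (lookup e zero) pair) edge′ , pair
  witness∈ : (Edge b ∩ Pair) witness
  witness∈ = trans (isEdge-⁅⁆∪first b i c<i) bi≡true , ∈-⁅⁆∪first j c
  witness∉ : ¬ (Edge b′ ∩ Pair) witness
  witness∉ (edge′ , _) =
    contradiction (trans (sym edge′) (trans (isEdge-⁅⁆∪first b′ i c<i) b′i≡false)) λ ()

agreeAbove⇒agree : ∀ {k n} → 2 ≤ k → (b b′ : Fin n → Bool) →
                   (∀ i → toℕ i < k ∸ 1 → b i ≡ false) →
                   (∀ i → toℕ i < k ∸ 1 → b′ i ≡ false) →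
                   (∀ i j → adjacency k b i j ≡ adjacency k b′ i j) →
                   ∀ i → (∀ {m} → i <ᶠ m → b m ≡ b′ m) → b i ≡ b′ i
agreeAbove⇒agree {suc zero} (s≤s ())
agreeAbove⇒agree {suc (suc c)} _ b b′ zeros zeros′ adj i agree with toℕ i <? suc c
... | yes i<k-1 = trans (zeros i i<k-1) (sym (zeros′ i i<k-1))
agreeAbove⇒agree _ _ _ _ _ _ zero _ | no 0≮k-1 = contradiction (s≤s z≤n) 0≮k-1
agreeAbove⇒agree _ b b′ _ _ adj (suc j) agree | no i≮k-1 with b (suc j) in bi | b′ (suc j) in b′i
... | true  | true  = refl
... | false | false = refl
... | true  | false = contradiction (sym (adj zero (suc j)))
                        (<⇒≢ (adjacency-< b b′ j (≮⇒≥ i≮k-1) (λ i<m → sym (agree i<m)) bi b′i))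
... | false | true  = contradiction (adj zero (suc j))
                        (<⇒≢ (adjacency-< b′ b j (≮⇒≥ i≮k-1) agree b′i bi))

proposition3 : (k n : ℕ) → 2 ≤ k → 1 ≤ n →
    (b b′ : Fin n → Bool) →
    (∀ i → toℕ i < k ∸ 1 → b i ≡ false) →
    (∀ i → toℕ i < k ∸ 1 → b′ i ≡ false) →
    (∀ i j → adjacency k b i j ≡ adjacency k b′ i j) →
    ∀ i → b i ≡ b′ i
proposition3 k n 2≤k _ b b′ zeros zeros′ adj =
  All.wfRec >-wellFounded 0ℓ (λ i → b i ≡ b′ i) (agreeAbove⇒agree 2≤k b b′ zeros zeros′ adj)
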